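{- For every theory $\mathsf T$ in the language $\mathcal L_\Box$, we have $\mathsf{GL}\neq\mathsf{PL}(\mathsf T)$.
   Context: $\mathsf{GL}$ is $\mathsf K$ plus $\Box A\to\Box\Box A$ and $\Box(\Box A\to A)\to\Box A$, in the language $\mathcal L_\Box$ (atomic propositions, $\bot$, $\to$, unary $\Box$), identified with its set of theorems. A theory $\mathsf T$ is a pair of a set of axioms and a set of inference rules; $\mathsf T\vdash A$ means derivability. A phrase is a formula $\bigwedge X\to\bigvee Y$ where $X,Y$ are finite disjoint sets of formulas each of which is an atom or of the form $\Box B$ (with a fixed ordering of conjuncts/disjuncts, $\bigwedge\emptyset=\top$, $\bigvee\emptyset=\bot$). Each formula $A$ is assigned its conjunctive normal form, a finite set $Z_A$ of phrases with $A$ classically equivalent to $\bigwedge Z_A$. For a phrase $\bigwedge X\to\bigvee Y$, its $\mathsf T$-interpretation is the metastatement "if $\mathsf T\vdash E$ for every $\Box E\in X$, then $\mathsf T\vdash F$ for some $\Box F\in Y$". For a formula $A$, $A^{\mathsf T}$ is the conjunction of the $\mathsf T$-interpretations of the phrases in $Z_A$. $\mathsf{PL}(\mathsf T)$ is the set of all $A\in\mathcal L_\Box$ such that $A^{\mathsf T}$ is true. -}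

module Defs where

open import Data.Nat using (ℕ)
import Data.Nat as ℕ
open import Data.List using (List; []; _∷_; _++_; filter; concatMap; map)
open import Data.List.Relation.Unary.All using (All)
open import Data.List.Relation.Unary.Any using (any?)
open import Data.List.Membership.Propositional using (_∈_)
open import Data.List.Membership.DecPropositional using () renaming (_∈?_ to ∈?-gen)
open import Data.Product using (Σ; _×_; _,_; proj₁; proj₂)
open import Relation.Nullary using (Dec; yes; no; ¬_)
open import Relation.Nullary.Decidable using (¬?)
open import Relation.Binary.PropositionalEquality using (_≡_; refl; cong; cong₂)
open import Relation.Binary.Definitions using (DecidableEquality)

infixr 6 _⇒_

data Fm : Set where
  var : ℕ → Fm
  ⊥'  : Fm
  _⇒_ : Fm → Fm → Fm
  □   : Fm → Fm

data GL⊢ : Fm → Set where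
  ax1  : ∀ A B → GL⊢ (A ⇒ B ⇒ A)
  ax2  : ∀ A B C → GL⊢ ((A ⇒ B ⇒ C) ⇒ (A ⇒ B) ⇒ A ⇒ C)
  ax3  : ∀ A → GL⊢ (((A ⇒ ⊥') ⇒ ⊥') ⇒ A)
  axK  : ∀ A B → GL⊢ (□ (A ⇒ B) ⇒ □ A ⇒ □ B)
  ax4  : ∀ A → GL⊢ (□ A ⇒ □ (□ A))
  axL  : ∀ A → GL⊢ (□ (□ A ⇒ A) ⇒ □ A)
  mp   : ∀ {A B} → GL⊢ (A ⇒ B) → GL⊢ A → GL⊢ B
  nec  : ∀ {A} → GL⊢ A → GL⊢ (□ A)

-- Theories: a set of axioms and a set of inference rules.
-- Each rule is a set of instances (finite list of premises, conclusion).

record Theory : Set₁ where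
  field
    Axiom     : Fm → Set
    RuleIndex : Set
    Rule      : RuleIndex → List Fm → Fm → Set

open Theory public

data _⊢_ (T : Theory) : Fm → Set where
  axiom : ∀ {A} → Axiom T A → T ⊢ A
  rule  : ∀ (r : RuleIndex T) {ps A} → Rule T r ps A → All (T ⊢_) ps → T ⊢ A

var-inj : ∀ {m n} → var m ≡ var n → m ≡ n
var-inj refl = refl

□-inj : ∀ {A B} → □ A ≡ □ B → A ≡ B
□-inj refl = refl

⇒-inj₁ : ∀ {A B C D} → (A ⇒ B) ≡ (C ⇒ D) → A ≡ C
⇒-inj₁ refl = refl

⇒-inj₂ : ∀ {A B C D} → (A ⇒ B) ≡ (C ⇒ D) → B ≡ D
⇒-inj₂ refl = refl

_≟F_ : DecidableEquality Fm
var m ≟F var n with m ℕ.≟ n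
... | yes refl = yes refl
... | no ne = no λ e → ne (var-inj e)
var _ ≟F ⊥' = no λ ()
var _ ≟F (_ ⇒ _) = no λ ()
var _ ≟F □ _ = no λ ()
⊥' ≟F var _ = no λ ()
⊥' ≟F ⊥' = yes refl
⊥' ≟F (_ ⇒ _) = no λ ()
⊥' ≟F □ _ = no λ ()
(_ ⇒ _) ≟F var _ = no λ ()
(_ ⇒ _) ≟F ⊥' = no λ ()
(A ⇒ B) ≟F (C ⇒ D) with A ≟F C | B ≟F D
... | yes refl | yes refl = yes refl
... | no ne | _ = no λ e → ne (⇒-inj₁ e)
... | yes _ | no ne = no λ e → ne (⇒-inj₂ e)
(_ ⇒ _) ≟F □ _ = no λ ()
□ _ ≟F var _ = no λ ()
□ _ ≟F ⊥' = no λ ()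
□ _ ≟F (_ ⇒ _) = no λ ()
□ A ≟F □ B with A ≟F B
... | yes refl = yes refl
... | no ne = no λ e → ne (□-inj e)

-- Phrases and conjunctive normal form.
-- A phrase  ⋀X → ⋁Y  is represented by the pair (X , Y) of lists whose
-- entries are atoms or boxed formulas.

Phrase : Set
Phrase = List Fm × List Fm

-- disjunction of two phrases: (¬⋀X₁ ∨ ⋁Y₁) ∨ (¬⋀X₂ ∨ ⋁Y₂)
_∨ᵖ_ : Phrase → Phrase → Phrase
(X₁ , Y₁) ∨ᵖ (X₂ , Y₂) = (X₁ ++ X₂ , Y₁ ++ Y₂)

-- pos A : list of phrases whose conjunction is classically equivalent to A
-- neg A : list of phrases whose conjunction is classically equivalent to ¬A
pos neg : Fm → List Phrase
pos (var p) = ([] , var p ∷ []) ∷ []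
pos ⊥'      = ([] , []) ∷ []
pos (A ⇒ B) = concatMap (λ c → map (c ∨ᵖ_) (pos B)) (neg A)
pos (□ A)   = ([] , □ A ∷ []) ∷ []
neg (var p) = (var p ∷ [] , []) ∷ []
neg ⊥'      = []
neg (A ⇒ B) = pos A ++ neg B
neg (□ A)   = (□ A ∷ [] , []) ∷ []

-- a phrase is a genuine phrase only if X and Y are disjoint;
-- phrases with X ∩ Y ≠ ∅ are tautologies and are dropped.
disjoint? : (c : Phrase) → Dec (¬ Data.List.Relation.Unary.Any.Any (λ x → x ∈ proj₂ c) (proj₁ c))
disjoint? (X , Y) = ¬? (any? (λ x → ∈?-gen _≟F_ x Y) X)

Z : Fm → List Phrase
Z A = filter disjoint? (pos A)

phraseInterp : Theory → Phrase → Set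
phraseInterp T (X , Y) =
  (∀ E → □ E ∈ X → T ⊢ E) → Σ Fm (λ F → □ F ∈ Y × T ⊢ F)

_^_ : Fm → Theory → Set
A ^ T = All (phraseInterp T) (Z A)

PL : Theory → Fm → Set
PL T A = A ^ T

-- If PL(T) ⊆ GL, then T is consistent: a proof of ⊥ in T makes □⊥ true
-- under the T-interpretation, but GL ⊬ □⊥.  Consistency of T in turn makes
-- ¬□⊥ true under the T-interpretation, whereas GL ⊬ ¬□⊥.  Both
-- unprovabilities are witnessed by the strict linear Kripke frame on ℕ, at
-- worlds 1 and 0 respectively.
module Submission where

open import Defs
open import Data.Bool using (Bool; false; T; T?)
open import Data.Empty using (⊥; ⊥-elim)
open import Data.List.Relation.Unary.All using ([]; _∷_)
open import Data.List.Relation.Unary.Any using (here)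
open import Data.Nat using (ℕ; zero; suc; _<_; s≤s)
open import Data.Nat.Properties using (<-trans; n<1+n; m<n⇒m<1+n; m≤n⇒m<n∨m≡n)
open import Data.Product using (_×_; _,_; proj₁; proj₂)
open import Data.Sum using (inj₁; inj₂)
open import Data.Unit using (⊤; tt)
open import Relation.Binary.PropositionalEquality using (refl)
open import Relation.Nullary using (¬_; Dec; yes; no; _→-dec_; _×-dec_)
open import Relation.Nullary.Decidable using (decidable-stable)

-- Kripke semantics on ℕ, where world n sees exactly the worlds k < n;
-- V p n is the truth value of the atom p at world n.
module Chain (V : ℕ → ℕ → Bool) where

  _⊩_ : ℕ → Fm → Set
  n     ⊩ var p   = T (V p n)
  n     ⊩ ⊥'      = ⊥
  n     ⊩ (A ⇒ B) = n ⊩ A → n ⊩ B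
  zero  ⊩ □ A     = ⊤
  suc n ⊩ □ A     = n ⊩ A × n ⊩ □ A

  _⊩?_ : ∀ n A → Dec (n ⊩ A)
  n     ⊩? var p   = T? (V p n)
  n     ⊩? ⊥'      = no λ ()
  n     ⊩? (A ⇒ B) = (n ⊩? A) →-dec (n ⊩? B)
  zero  ⊩? □ A     = yes tt
  suc n ⊩? □ A     = (n ⊩? A) ×-dec (n ⊩? □ A)

  □-elim : ∀ {n k A} → n ⊩ □ A → k < n → k ⊩ A
  □-elim {suc n} (nA , n□A) (s≤s k≤n) with m≤n⇒m<n∨m≡n k≤n
  ... | inj₁ k<n  = □-elim n□A k<n
  ... | inj₂ refl = nA

  □-intro : ∀ n {A} → (∀ {k} → k < n → k ⊩ A) → n ⊩ □ A
  □-intro zero    h = tt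
  □-intro (suc n) h = h (n<1+n n) , □-intro n (λ k<n → h (m<n⇒m<1+n k<n))

  □-löb : ∀ n {A} → n ⊩ □ (□ A ⇒ A) → n ⊩ □ A
  □-löb zero    _           = tt
  □-löb (suc n) (step , h) = step (□-löb n h) , □-löb n h

  GL-sound : ∀ {A} → GL⊢ A → ∀ n → n ⊩ A
  GL-sound (ax1 A B)   n = λ a _ → a
  GL-sound (ax2 A B C) n = λ f g a → f a (g a)
  GL-sound (ax3 A)     n = decidable-stable (n ⊩? A)
  GL-sound (axK A B)   n = λ f a → □-intro n λ k<n → □-elim f k<n (□-elim a k<n)
  GL-sound (ax4 A)     n = λ a → □-intro n λ k<n → □-intro _ λ j<k → □-elim a (<-trans j<k k<n)
  GL-sound (axL A)     n = □-löb n
  GL-sound (mp d e)    n = GL-sound d n (GL-sound e n)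
  GL-sound (nec d)     n = □-intro n λ _ → GL-sound d _

open Chain (λ _ _ → false) using (GL-sound)

GL⊬□⊥ : ¬ GL⊢ (□ ⊥')
GL⊬□⊥ d = proj₁ (GL-sound d 1)

GL⊬¬□⊥ : ¬ GL⊢ (□ ⊥' ⇒ ⊥')
GL⊬¬□⊥ d = GL-sound d 0 tt

PL-□ : ∀ {T A} → T ⊢ A → PL T (□ A)
PL-□ {A = A} d = (λ _ → A , here refl , d) ∷ []

PL-¬□ : ∀ {T A} → ¬ (T ⊢ A) → PL T (□ A ⇒ ⊥')
PL-¬□ T⊬A = (λ T⊢X → ⊥-elim (T⊬A (T⊢X _ (here refl)))) ∷ []

PL⊈GL : (T : Theory) → ¬ (∀ A → PL T A → GL⊢ A)
PL⊈GL T PL⊆GL = GL⊬¬□⊥ (PL⊆GL _ (PL-¬□ T⊬⊥))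
  where
  T⊬⊥ : ¬ (T ⊢ ⊥')
  T⊬⊥ d = GL⊬□⊥ (PL⊆GL _ (PL-□ d))

theoremA3 : (T : Theory) → ¬ (∀ (A : Fm) → (GL⊢ A → PL T A) × (PL T A → GL⊢ A))
theoremA3 T GL≡PL = PL⊈GL T (λ A → proj₂ (GL≡PL A))
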